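{- Let $f:\mathbb{N}\to\mathbb{R}$ be a nonnegative arithmetic function and let $k\ge 2$ be an integer. If $f$ is sub-multiplicative and super-homogeneous, then $f$ is $k$-super-homogeneous. If $f$ is super-multiplicative and sub-homogeneous, then $f$ is $k$-sub-homogeneous.
   Context: $\mathbb{N}=\{1,2,3,\dots\}$. $f$ is sub-multiplicative if $f(mn)\le f(m)f(n)$ for all $m,n\ge1$, super-multiplicative if $f(mn)\ge f(m)f(n)$ for all $m,n\ge1$. $f$ is sub-homogeneous if $f(mn)\le m f(n)$ for all $m,n\ge1$, super-homogeneous if $f(mn)\ge m f(n)$ for all $m,n\ge1$. For an integer $k\ge2$, $f$ is $k$-sub-homogeneous if $\big(f(mn)\big)^k\le m^k f(n^k)$ for all $m,n\ge1$, and $k$-super-homogeneous if $\big(f(mn)\big)^k\ge m^k f(n^k)$ for all $m,n\ge1$. -}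

module Defs where

open import Level using (Level; 0ℓ)
open import Data.Nat using (ℕ; zero; suc) renaming (_≤_ to _≤ℕ_)
open import Data.Product using (Σ; _×_; ∃)
open import Data.Sum using (_⊎_)
open import Relation.Nullary using (¬_)
open import Relation.Binary.PropositionalEquality using (_≡_)
open import Algebra.Structures using (IsCommutativeRing)

-- The real numbers, axiomatized (stdlib has no ℝ) as a Dedekind-complete
-- ordered field, in the style of Coq's Rdefinitions/Raxioms.  Any two such
-- structures are isomorphic (classically), so quantifying over all of them
-- is quantifying over "the" reals.
record RealField : Set₁ where
  infixl 6 _+_
  infixl 7 _*_
  infix  4 _<_ _≤_
  field
    ℝ    : Set
    0# 1# : ℝ
    _+_ _*_ : ℝ → ℝ → ℝ
    -_   : ℝ → ℝ
    isCommutativeRing : IsCommutativeRing _≡_ _+_ _*_ -_ 0# 1#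
    _⁻¹  : ℝ → ℝ
    ⁻¹-inverse : ∀ x → ¬ (x ≡ 0#) → x * (x ⁻¹) ≡ 1#
    0≢1  : ¬ (0# ≡ 1#)
    _<_  : ℝ → ℝ → Set
    <-irrefl : ∀ x → ¬ (x < x)
    <-trans  : ∀ {x y z} → x < y → y < z → x < z
    <-trichotomy : ∀ x y → x < y ⊎ (x ≡ y ⊎ y < x)
    +-mono-< : ∀ {x y} z → x < y → x + z < y + z
    *-pos    : ∀ {x y} → 0# < x → 0# < y → 0# < x * y
    completeness : (E : ℝ → Set) →
                   (Σ ℝ λ b → ∀ x → E x → x < b ⊎ x ≡ b) →
                   (Σ ℝ λ x → E x) →
                   Σ ℝ λ s → (∀ x → E x → x < s ⊎ x ≡ s) ×
                             (∀ b → (∀ x → E x → x < b ⊎ x ≡ b) → s < b ⊎ s ≡ b)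

  _≤_ : ℝ → ℝ → Set
  x ≤ y = x < y ⊎ x ≡ y

  fromℕ : ℕ → ℝ
  fromℕ zero    = 0#
  fromℕ (suc n) = 1# + fromℕ n

  infixr 8 _^_
  _^_ : ℝ → ℕ → ℝ
  x ^ zero  = 1#
  x ^ suc k = x * (x ^ k)

module Notions (R : RealField) where
  open RealField R
  open import Data.Nat using () renaming (_*_ to _*ℕ_; _^_ to _^ℕ_)

  -- f is viewed as a function on ℕ = {1,2,…}; its value at 0 is irrelevant:
  -- all conditions quantify over m,n ≥ 1.
  Nonnegative : (ℕ → ℝ) → Set
  Nonnegative f = ∀ n → 1 ≤ℕ n → 0# ≤ f n

  SubMultiplicative : (ℕ → ℝ) → Set
  SubMultiplicative f = ∀ m n → 1 ≤ℕ m → 1 ≤ℕ n → f (m *ℕ n) ≤ f m * f n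

  SuperMultiplicative : (ℕ → ℝ) → Set
  SuperMultiplicative f = ∀ m n → 1 ≤ℕ m → 1 ≤ℕ n → f m * f n ≤ f (m *ℕ n)

  SubHomogeneous : (ℕ → ℝ) → Set
  SubHomogeneous f = ∀ m n → 1 ≤ℕ m → 1 ≤ℕ n → f (m *ℕ n) ≤ fromℕ m * f n

  SuperHomogeneous : (ℕ → ℝ) → Set
  SuperHomogeneous f = ∀ m n → 1 ≤ℕ m → 1 ≤ℕ n → fromℕ m * f n ≤ f (m *ℕ n)

  KSubHomogeneous : ℕ → (ℕ → ℝ) → Set
  KSubHomogeneous k f = ∀ m n → 1 ≤ℕ m → 1 ≤ℕ n →
    f (m *ℕ n) ^ k ≤ fromℕ m ^ k * f (n ^ℕ k)

  KSuperHomogeneous : ℕ → (ℕ → ℝ) → Set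
  KSuperHomogeneous k f = ∀ m n → 1 ≤ℕ m → 1 ≤ℕ n →
    fromℕ m ^ k * f (n ^ℕ k) ≤ f (m *ℕ n) ^ k

-- By sub-multiplicativity f (n ^ k) ≤ f n ^ k, and raising super-homogeneity
-- m f n ≤ f (m n) to the k-th power (both sides are nonnegative) gives
-- m ^ k f n ^ k ≤ f (m n) ^ k; chaining the two proves k-super-homogeneity.
-- The second implication is the same argument with every inequality reversed.
-- Nothing beyond k ≥ 1 is used.
module Submission where

open import Defs
open import Data.Nat using (ℕ; zero; suc; s≤s)
  renaming (_≤_ to _≤ℕ_; _*_ to _*ℕ_; _^_ to _^ℕ_)
import Data.Nat.Properties as ℕ
open import Data.Product using (_×_; _,_)
open import Data.Sum using (inj₁; inj₂)
open import Data.Empty using (⊥-elim)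
open import Relation.Binary.PropositionalEquality
  using (_≡_; refl; sym; trans; cong; subst; subst₂)
open import Algebra.Bundles using (CommutativeRing)
open import Algebra.Structures using (IsCommutativeRing)

module OrderedFieldProperties (R : RealField) where
  open RealField R
  open IsCommutativeRing isCommutativeRing
    using (+-comm; *-comm; zeroˡ; zeroʳ; -‿inverseʳ; +-identityˡ; +-identityʳ; *-identityˡ; *-identityʳ)

  commutativeRing : CommutativeRing _ _
  commutativeRing = record { isCommutativeRing = isCommutativeRing }

  open CommutativeRing commutativeRing using (_-_)
  open import Algebra.Properties.Ring (CommutativeRing.ring commutativeRing)
    using (-‿distribˡ-*; -‿involutive; //-rightDividesˡ; [y-z]x≈yx-zx)
  open import Algebra.Properties.CommutativeSemigroup
    (CommutativeRing.*-commutativeSemigroup commutativeRing) using (interchange)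

  ≤-refl : ∀ {x} → x ≤ x
  ≤-refl = inj₂ refl

  ≤-trans : ∀ {x y z} → x ≤ y → y ≤ z → x ≤ z
  ≤-trans (inj₁ x<y) (inj₁ y<z) = inj₁ (<-trans x<y y<z)
  ≤-trans (inj₁ x<y) (inj₂ refl) = inj₁ x<y
  ≤-trans (inj₂ refl) y≤z = y≤z

  x<y⇒0<y-x : ∀ {x y} → x < y → 0# < y - x
  x<y⇒0<y-x {x} {y} x<y = subst (_< y - x) (-‿inverseʳ x) (+-mono-< (- x) x<y)

  0<y-x⇒x<y : ∀ {x y} → 0# < y - x → x < y
  0<y-x⇒x<y {x} {y} 0<y-x = subst₂ _<_ (+-identityˡ x) (//-rightDividesˡ x y) (+-mono-< x 0<y-x)

  *-monoˡ-< : ∀ {x y z} → 0# < z → x < y → x * z < y * z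
  *-monoˡ-< {x} {y} {z} 0<z x<y =
    0<y-x⇒x<y (subst (0# <_) ([y-z]x≈yx-zx z y x) (*-pos (x<y⇒0<y-x x<y) 0<z))

  *-monoˡ-≤ : ∀ {x y z} → 0# ≤ z → x ≤ y → x * z ≤ y * z
  *-monoˡ-≤ {x} {y} (inj₂ refl) _ = inj₂ (trans (zeroʳ x) (sym (zeroʳ y)))
  *-monoˡ-≤ (inj₁ 0<z) (inj₁ x<y) = inj₁ (*-monoˡ-< 0<z x<y)
  *-monoˡ-≤ (inj₁ _) (inj₂ refl) = ≤-refl

  *-monoʳ-≤ : ∀ {x y z} → 0# ≤ z → x ≤ y → z * x ≤ z * y
  *-monoʳ-≤ {x} {y} {z} 0≤z x≤y = subst₂ _≤_ (*-comm x z) (*-comm y z) (*-monoˡ-≤ 0≤z x≤y)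

  *-nonNeg : ∀ {x y} → 0# ≤ x → 0# ≤ y → 0# ≤ x * y
  *-nonNeg {x} {y} 0≤x 0≤y = subst (_≤ x * y) (zeroˡ y) (*-monoˡ-≤ 0≤y 0≤x)

  -- If 1 < 0 then 0 < - 1, hence 0 < (- 1) * (- 1) = 1.
  0<1 : 0# < 1#
  0<1 with <-trichotomy 0# 1#
  ... | inj₁ 0<1 = 0<1
  ... | inj₂ (inj₁ 0≡1) = ⊥-elim (0≢1 0≡1)
  ... | inj₂ (inj₂ 1<0) = ⊥-elim (<-irrefl 0# (<-trans 0<1′ 1<0))
    where
    0<-1 : 0# < - 1#
    0<-1 = subst₂ _<_ (-‿inverseʳ 1#) (+-identityˡ (- 1#)) (+-mono-< (- 1#) 1<0)
    -1*-1≡1 : - 1# * - 1# ≡ 1#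
    -1*-1≡1 = trans (sym (-‿distribˡ-* 1# (- 1#)))
                    (trans (cong -_ (*-identityˡ (- 1#))) (-‿involutive 1#))
    0<1′ : 0# < 1#
    0<1′ = subst (0# <_) -1*-1≡1 (*-pos 0<-1 0<-1)

  +-monoʳ-< : ∀ {x y} z → x < y → z + x < z + y
  +-monoʳ-< {x} {y} z x<y = subst₂ _<_ (+-comm x z) (+-comm y z) (+-mono-< z x<y)

  0≤x⇒0<1+x : ∀ {x} → 0# ≤ x → 0# < 1# + x
  0≤x⇒0<1+x (inj₂ refl) = subst (0# <_) (sym (+-identityʳ 1#)) 0<1
  0≤x⇒0<1+x (inj₁ 0<x) = <-trans (0≤x⇒0<1+x ≤-refl) (+-monoʳ-< 1# 0<x)

  fromℕ-nonNeg : ∀ n → 0# ≤ fromℕ n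
  fromℕ-nonNeg zero = ≤-refl
  fromℕ-nonNeg (suc n) = inj₁ (0≤x⇒0<1+x (fromℕ-nonNeg n))

  ^-nonNeg : ∀ {x} k → 0# ≤ x → 0# ≤ x ^ k
  ^-nonNeg zero _ = inj₁ 0<1
  ^-nonNeg (suc k) 0≤x = *-nonNeg 0≤x (^-nonNeg k 0≤x)

  ^-monoˡ-≤ : ∀ {x y} k → 0# ≤ x → x ≤ y → x ^ k ≤ y ^ k
  ^-monoˡ-≤ zero _ _ = ≤-refl
  ^-monoˡ-≤ (suc k) 0≤x x≤y =
    ≤-trans (*-monoˡ-≤ (^-nonNeg k 0≤x) x≤y) (*-monoʳ-≤ (≤-trans 0≤x x≤y) (^-monoˡ-≤ k 0≤x x≤y))

  ^-distribʳ-* : ∀ x y k → (x * y) ^ k ≡ x ^ k * y ^ k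
  ^-distribʳ-* x y zero = sym (*-identityʳ 1#)
  ^-distribʳ-* x y (suc k) = trans (cong ((x * y) *_) (^-distribʳ-* x y k)) (interchange x y (x ^ k) (y ^ k))

module Homogeneity (R : RealField) where
  open RealField R
  open Notions R
  open OrderedFieldProperties R
  open IsCommutativeRing isCommutativeRing using (*-identityʳ)

  1≤n^k : ∀ {n} k → 1 ≤ℕ n → 1 ≤ℕ n ^ℕ k
  1≤n^k {suc n} k _ = ℕ.m^n>0 (suc n) k

  module _ {f : ℕ → ℝ} (f-nonNeg : Nonnegative f) where

    subMultiplicative⇒f[n^k]≤f[n]^k : SubMultiplicative f →
      ∀ k {n} → 1 ≤ℕ n → f (n ^ℕ suc k) ≤ f n ^ suc k
    subMultiplicative⇒f[n^k]≤f[n]^k _ zero {n} _ =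
      subst (λ i → f i ≤ f n ^ 1) (sym (ℕ.*-identityʳ n)) (inj₂ (sym (*-identityʳ (f n))))
    subMultiplicative⇒f[n^k]≤f[n]^k sub (suc k) {n} 1≤n =
      ≤-trans (sub n (n ^ℕ suc k) 1≤n (1≤n^k (suc k) 1≤n))
              (*-monoʳ-≤ (f-nonNeg n 1≤n) (subMultiplicative⇒f[n^k]≤f[n]^k sub k 1≤n))

    superMultiplicative⇒f[n]^k≤f[n^k] : SuperMultiplicative f →
      ∀ k {n} → 1 ≤ℕ n → f n ^ suc k ≤ f (n ^ℕ suc k)
    superMultiplicative⇒f[n]^k≤f[n^k] _ zero {n} _ =
      subst (λ i → f n ^ 1 ≤ f i) (sym (ℕ.*-identityʳ n)) (inj₂ (*-identityʳ (f n)))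
    superMultiplicative⇒f[n]^k≤f[n^k] super (suc k) {n} 1≤n =
      ≤-trans (*-monoʳ-≤ (f-nonNeg n 1≤n) (superMultiplicative⇒f[n]^k≤f[n^k] super k 1≤n))
              (super n (n ^ℕ suc k) 1≤n (1≤n^k (suc k) 1≤n))

    subMultiplicative∧superHomogeneous⇒kSuperHomogeneous :
      SubMultiplicative f → SuperHomogeneous f → ∀ k → KSuperHomogeneous (suc k) f
    subMultiplicative∧superHomogeneous⇒kSuperHomogeneous sub homo k m n 1≤m 1≤n =
      ≤-trans (*-monoʳ-≤ (^-nonNeg (suc k) (fromℕ-nonNeg m))
                         (subMultiplicative⇒f[n^k]≤f[n]^k sub k 1≤n))
              (subst (_≤ f (m *ℕ n) ^ suc k) (^-distribʳ-* (fromℕ m) (f n) (suc k))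
                     (^-monoˡ-≤ (suc k) (*-nonNeg (fromℕ-nonNeg m) (f-nonNeg n 1≤n))
                                (homo m n 1≤m 1≤n)))

    superMultiplicative∧subHomogeneous⇒kSubHomogeneous :
      SuperMultiplicative f → SubHomogeneous f → ∀ k → KSubHomogeneous (suc k) f
    superMultiplicative∧subHomogeneous⇒kSubHomogeneous super homo k m n 1≤m 1≤n =
      ≤-trans (subst (f (m *ℕ n) ^ suc k ≤_) (^-distribʳ-* (fromℕ m) (f n) (suc k))
                     (^-monoˡ-≤ (suc k) (f-nonNeg (m *ℕ n) (ℕ.*-mono-≤ 1≤m 1≤n))
                                (homo m n 1≤m 1≤n)))
              (*-monoʳ-≤ (^-nonNeg (suc k) (fromℕ-nonNeg m))
                         (superMultiplicative⇒f[n]^k≤f[n^k] super k 1≤n))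

theorem3 : (R : RealField) → let open Notions R in
    (f : ℕ → RealField.ℝ R) → Nonnegative f → (k : ℕ) → 2 ≤ℕ k →
    (SubMultiplicative f × SuperHomogeneous f → KSuperHomogeneous k f) ×
    (SuperMultiplicative f × SubHomogeneous f → KSubHomogeneous k f)
theorem3 R f f-nonNeg (suc k) (s≤s _) =
    (λ (sub , homo) → subMultiplicative∧superHomogeneous⇒kSuperHomogeneous f-nonNeg sub homo k)
  , (λ (super , homo) → superMultiplicative∧subHomogeneous⇒kSubHomogeneous f-nonNeg super homo k)
  where open Homogeneity R
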